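{- Let $\Gamma=\langle S\rangle\le\operatorname{Sym}(\Omega)$ be a finite permutation group given by a generating set $S$, and let $\mathcal{C}(S)$ be its cycle type graph. Then the cycle type graph and the centralizer $C_{\operatorname{Sym}(\Omega)}(\Gamma)=\{b\in\operatorname{Sym}(\Omega): b\varphi=\varphi b\ \forall\varphi\in\Gamma\}$ form a joint graph/group pair in the sense that restriction $b\mapsto b|_\Omega$ is an isomorphism from $\operatorname{Aut}(\mathcal{C}(S))$ onto $C_{\operatorname{Sym}(\Omega)}(\Gamma)$.
   Context: For $g\in\operatorname{Sym}(\Omega)$, $\operatorname{supp}(g)=\{x:g(x)\neq x\}$. Enumerate $S=\{s_1,\dots,s_m\}$. The cycle type graph $\mathcal{C}(S)$ is the vertex-colored mixed graph with vertex set the disjoint union $\Omega\,\dot\cup\,\dot\bigcup_{i=1}^m\{(i,x):x\in\operatorname{supp}(s_i)\}$; each copy $(i,x)$ is joined by an undirected edge to $x\in\Omega$; there are directed edges $(i,x)\to(i,s_i(x))$ for all $x\in\operatorname{supp}(s_i)$; vertices of $\Omega$ get color $0$ and $(i,x)$ gets color $(i,t)$ where $t$ is the length of the cycle of $s_i$ containing $x$. An automorphism of $\mathcal{C}(S)$ is a bijection of its vertices preserving colors, undirected edges, and directed edges (with direction); it maps $\Omega$ to $\Omega$. -}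

module Defs where

open import Data.Nat using (ℕ; zero; suc)
open import Data.Fin using (Fin)
open import Data.Fin.Properties using (_≟_)
open import Data.Fin.Permutation using (Permutation′; _⟨$⟩ʳ_; _⟨$⟩ˡ_)
open import Data.Bool using (Bool; true; false)
open import Data.List using (List; []; _∷_)
open import Data.Maybe using (Maybe; nothing; just)
open import Data.Product using (Σ; _×_; _,_)
open import Data.Sum using (_⊎_; inj₁; inj₂)
open import Data.Empty using (⊥)
open import Function.Bundles using (_↔_; _⇔_; Inverse)
open import Relation.Nullary using (yes; no)
open import Relation.Nullary.Decidable using (False)
open import Relation.Binary.PropositionalEquality using (_≡_)

-- Ω = Fin n ; a generating set S = {s_1,…,s_m} is enumerated as S : Fin m → Sym(Fin n).

module _ {n m : ℕ} (S : Fin m → Permutation′ n) where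

  -- support of s_i : x with s_i(x) ≠ x  (False(…) has unique proofs)
  Supp : Fin m → Set
  Supp i = Σ (Fin n) λ x → False ((S i ⟨$⟩ʳ x) ≟ x)

  V : Set
  V = Fin n ⊎ Σ (Fin m) Supp

  iter : Permutation′ n → ℕ → Fin n → Fin n
  iter s zero x = x
  iter s (suc k) x = s ⟨$⟩ʳ iter s k x

  firstReturn : Permutation′ n → Fin n → ℕ → ℕ → ℕ
  firstReturn s x zero k = k
  firstReturn s x (suc fuel) k with iter s k x ≟ x
  ... | yes _ = k
  ... | no _ = firstReturn s x fuel (suc k)

  -- length of the cycle of s containing x: least t ≥ 1 with s^t x = x
  -- (such t ≤ n always exists, so n search steps suffice)
  cycleLen : Permutation′ n → Fin n → ℕ
  cycleLen s x = firstReturn s x n 1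

  -- colours: nothing = colour 0 (vertices of Ω), just (i , t) = colour (i,t)
  colour : V → Maybe (Fin m × ℕ)
  colour (inj₁ x) = nothing
  colour (inj₂ (i , x , _)) = just (i , cycleLen (S i) x)

  UEdge : V → V → Set
  UEdge (inj₁ x) (inj₁ y) = ⊥
  UEdge (inj₁ x) (inj₂ (i , y , _)) = x ≡ y
  UEdge (inj₂ (i , y , _)) (inj₁ x) = x ≡ y
  UEdge (inj₂ _) (inj₂ _) = ⊥

  DEdge : V → V → Set
  DEdge (inj₁ _) _ = ⊥
  DEdge (inj₂ _) (inj₁ _) = ⊥
  DEdge (inj₂ (i , x , _)) (inj₂ (j , y , _)) = (i ≡ j) × (y ≡ S i ⟨$⟩ʳ x)

  record Aut : Set where
    field
      bij : V ↔ V
    to : V → V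
    to = Inverse.to bij
    field
      colour-pres : ∀ v → colour (to v) ≡ colour v
      uedge-pres : ∀ u v → UEdge u v ⇔ UEdge (to u) (to v)
      dedge-pres : ∀ u v → DEdge u v ⇔ DEdge (to u) (to v)

  Restricts : Aut → Permutation′ n → Set
  Restricts b c = ∀ x → Aut.to b (inj₁ x) ≡ inj₁ (c ⟨$⟩ʳ x)

  -- Γ = ⟨S⟩ = values of words in the generators and their inverses
  -- (true = s_i, false = s_i⁻¹)
  Word : Set
  Word = List (Fin m × Bool)

  evalWord : Word → Fin n → Fin n
  evalWord [] x = x
  evalWord ((i , true) ∷ w) x = S i ⟨$⟩ʳ evalWord w x
  evalWord ((i , false) ∷ w) x = S i ⟨$⟩ˡ evalWord w x

  InCentralizer : Permutation′ n → Set
  InCentralizer b = ∀ (w : Word) (x : Fin n) → b ⟨$⟩ʳ evalWord w x ≡ evalWord w (b ⟨$⟩ʳ x)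

{-# OPTIONS --safe #-}
-- An automorphism of C(S) preserves colour 0, so it permutes Ω. A copy (i , x) keeps its
-- colour, hence its generator i, and its undirected edge forces its image to be (i , b x);
-- so b is determined by b|Ω, and the directed edges (i , x) → (i , s_i x) say that b|Ω
-- commutes with s_i on supp(s_i). Off the support commutation means that b|Ω preserves the
-- fixed points of s_i, which follows by pulling the copy (i , b x) back along b. Conversely a
-- permutation commuting with every s_i preserves supports and cycle lengths, so it lifts
-- to the copies (i , x) ↦ (i , c x).
module Submission where

open import Defs
open import Data.Nat using (ℕ; zero; suc)
open import Data.Fin using (Fin)
open import Data.Fin.Properties using (_≟_)
open import Data.Fin.Permutation using (Permutation′; _⟨$⟩ʳ_; _⟨$⟩ˡ_; inverseˡ; inverseʳ; permutation; flip)
open import Data.Bool using (true; false)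
open import Data.Bool.Properties using (T-irrelevant)
open import Data.List using ([]; _∷_)
open import Data.Maybe using (nothing; just)
open import Data.Product using (Σ; _×_; _,_; proj₁; proj₂)
open import Data.Sum using (inj₁; inj₂)
open import Data.Sum.Properties using (inj₁-injective)
open import Data.Empty using (⊥-elim)
open import Function.Bundles using (_⇔_; Inverse; Injection; Equivalence; mk⇔; mk↔ₛ′)
open import Function.Properties.Inverse using (↔⇒↣)
open import Relation.Nullary using (yes; no)
open import Relation.Nullary.Decidable using (False; toWitnessFalse; fromWitnessFalse)
open import Relation.Binary.PropositionalEquality using (_≡_; refl; sym; trans; cong; subst; subst₂; module ≡-Reasoning)

⟨$⟩ʳ-injective : ∀ {n} (π : Permutation′ n) {x y : Fin n} → π ⟨$⟩ʳ x ≡ π ⟨$⟩ʳ y → x ≡ y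
⟨$⟩ʳ-injective π = Injection.injective (↔⇒↣ π)

commute-inverse : ∀ {n} (f : Fin n → Fin n) (s : Permutation′ n) →
  (∀ x → f (s ⟨$⟩ʳ x) ≡ s ⟨$⟩ʳ f x) → ∀ y → f (s ⟨$⟩ˡ y) ≡ s ⟨$⟩ˡ f y
commute-inverse f s comm y = begin
  f (s ⟨$⟩ˡ y)                    ≡⟨ inverseˡ s ⟨
  s ⟨$⟩ˡ (s ⟨$⟩ʳ f (s ⟨$⟩ˡ y))     ≡⟨ cong (s ⟨$⟩ˡ_) (comm (s ⟨$⟩ˡ y)) ⟨
  s ⟨$⟩ˡ f (s ⟨$⟩ʳ (s ⟨$⟩ˡ y))     ≡⟨ cong (λ z → s ⟨$⟩ˡ f z) (inverseʳ s) ⟩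
  s ⟨$⟩ˡ f y                      ∎
  where open ≡-Reasoning

module _ {n m : ℕ} (S : Fin m → Permutation′ n) where

  CommutesWithGenerators : (Fin n → Fin n) → Set
  CommutesWithGenerators f = ∀ i x → f (S i ⟨$⟩ʳ x) ≡ S i ⟨$⟩ʳ f x

  InCentralizer⇒commutesWithGenerators : ∀ c → InCentralizer S c → CommutesWithGenerators (c ⟨$⟩ʳ_)
  InCentralizer⇒commutesWithGenerators c central i = central ((i , true) ∷ [])

  commutesWithGenerators⇒InCentralizer : ∀ c → CommutesWithGenerators (c ⟨$⟩ʳ_) → InCentralizer S c
  commutesWithGenerators⇒InCentralizer c comm [] x = refl
  commutesWithGenerators⇒InCentralizer c comm ((i , true) ∷ w) x =
    trans (comm i _) (cong (S i ⟨$⟩ʳ_) (commutesWithGenerators⇒InCentralizer c comm w x))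
  commutesWithGenerators⇒InCentralizer c comm ((i , false) ∷ w) x =
    trans (commute-inverse (c ⟨$⟩ʳ_) (S i) (comm i) _)
          (cong (S i ⟨$⟩ˡ_) (commutesWithGenerators⇒InCentralizer c comm w x))

  copy-≡ : ∀ {i x y} {p : False ((S i ⟨$⟩ʳ x) ≟ x)} {q : False ((S i ⟨$⟩ʳ y) ≟ y)} →
    x ≡ y → _≡_ {A = V S} (inj₂ (i , x , p)) (inj₂ (i , y , q))
  copy-≡ {p = p} {q} refl = cong (λ r → inj₂ (_ , _ , r)) (T-irrelevant p q)

  copy-base-injective : ∀ {i j x y} {p : False ((S i ⟨$⟩ʳ x) ≟ x)} {q : False ((S j ⟨$⟩ʳ y) ≟ y)} →
    _≡_ {A = V S} (inj₂ (i , x , p)) (inj₂ (j , y , q)) → x ≡ y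
  copy-base-injective refl = refl

  colour-nothing⇒base : ∀ v → colour S v ≡ nothing → Σ (Fin n) λ y → v ≡ inj₁ y
  colour-nothing⇒base (inj₁ y) _ = y , refl

  colour-just⇒copy : ∀ v i t → colour S v ≡ just (i , t) → Σ (Supp S i) λ y → v ≡ inj₂ (i , y)
  colour-just⇒copy (inj₂ (j , y)) .j ._ refl = y , refl

  support-closed : ∀ i x → False ((S i ⟨$⟩ʳ x) ≟ x) →
    False ((S i ⟨$⟩ʳ (S i ⟨$⟩ʳ x)) ≟ (S i ⟨$⟩ʳ x))
  support-closed i x p = fromWitnessFalse (λ e → toWitnessFalse p (⟨$⟩ʳ-injective (S i) e))

  module _ (s π : Permutation′ n) (comm : ∀ x → π ⟨$⟩ʳ (s ⟨$⟩ʳ x) ≡ s ⟨$⟩ʳ (π ⟨$⟩ʳ x)) where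

    iter-commute : ∀ k x → iter S s k (π ⟨$⟩ʳ x) ≡ π ⟨$⟩ʳ iter S s k x
    iter-commute zero x = refl
    iter-commute (suc k) x = trans (cong (s ⟨$⟩ʳ_) (iter-commute k x)) (sym (comm _))

    firstReturn-commute : ∀ x fuel k → firstReturn S s (π ⟨$⟩ʳ x) fuel k ≡ firstReturn S s x fuel k
    firstReturn-commute x zero k = refl
    firstReturn-commute x (suc fuel) k
      with iter S s k (π ⟨$⟩ʳ x) ≟ π ⟨$⟩ʳ x | iter S s k x ≟ x
    ... | yes _  | yes _  = refl
    ... | no _   | no _   = firstReturn-commute x fuel (suc k)
    ... | yes e  | no ne  = ⊥-elim (ne (⟨$⟩ʳ-injective π (trans (sym (iter-commute k x)) e)))
    ... | no ne  | yes e  = ⊥-elim (ne (trans (iter-commute k x) (cong (π ⟨$⟩ʳ_) e)))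

    cycleLen-commute : ∀ x → cycleLen S s (π ⟨$⟩ʳ x) ≡ cycleLen S s x
    cycleLen-commute x = firstReturn-commute x n 1

  module Lift (π : Permutation′ n) (comm : CommutesWithGenerators (π ⟨$⟩ʳ_)) where

    lift : V S → V S
    lift (inj₁ x) = inj₁ (π ⟨$⟩ʳ x)
    lift (inj₂ (i , x , p)) =
      inj₂ (i , π ⟨$⟩ʳ x , fromWitnessFalse (λ e → toWitnessFalse p (⟨$⟩ʳ-injective π (trans (comm i x) e))))

    lift-colour : ∀ v → colour S (lift v) ≡ colour S v
    lift-colour (inj₁ x) = refl
    lift-colour (inj₂ (i , x , p)) = cong (λ t → just (i , t)) (cycleLen-commute (S i) π (comm i) x)

    lift-uedge : ∀ u v → UEdge S u v ⇔ UEdge S (lift u) (lift v)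
    lift-uedge (inj₁ x) (inj₁ y) = mk⇔ (λ ()) (λ ())
    lift-uedge (inj₁ x) (inj₂ _) = mk⇔ (cong (π ⟨$⟩ʳ_)) (⟨$⟩ʳ-injective π)
    lift-uedge (inj₂ _) (inj₁ x) = mk⇔ (cong (π ⟨$⟩ʳ_)) (⟨$⟩ʳ-injective π)
    lift-uedge (inj₂ _) (inj₂ _) = mk⇔ (λ ()) (λ ())

    lift-dedge : ∀ u v → DEdge S u v ⇔ DEdge S (lift u) (lift v)
    lift-dedge (inj₁ _) _ = mk⇔ (λ ()) (λ ())
    lift-dedge (inj₂ _) (inj₁ _) = mk⇔ (λ ()) (λ ())
    lift-dedge (inj₂ (i , x , _)) (inj₂ _) =
      mk⇔ (λ { (i≡j , e) → i≡j , trans (cong (π ⟨$⟩ʳ_) e) (comm i x) })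
          (λ { (i≡j , e) → i≡j , ⟨$⟩ʳ-injective π (trans e (sym (comm i x))) })

  open Lift using (lift)

  lift-inverse : ∀ π comm comm′ v → lift π comm (lift (flip π) comm′ v) ≡ v
  lift-inverse π comm comm′ (inj₁ x) = cong inj₁ (inverseʳ π)
  lift-inverse π comm comm′ (inj₂ _) = copy-≡ (inverseʳ π)

  liftAut : ∀ c → CommutesWithGenerators (c ⟨$⟩ʳ_) → Aut S
  liftAut c comm = record
    { bij = mk↔ₛ′ (lift c comm) (lift (flip c) comm⁻¹) (lift-inverse c comm comm⁻¹) (lift-inverse (flip c) comm⁻¹ comm)
    ; colour-pres = Lift.lift-colour c comm
    ; uedge-pres = Lift.lift-uedge c comm
    ; dedge-pres = Lift.lift-dedge c comm
    }
    where
      comm⁻¹ : CommutesWithGenerators (flip c ⟨$⟩ʳ_)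
      comm⁻¹ i x = sym (commute-inverse (S i ⟨$⟩ʳ_) c (λ y → sym (comm i y)) x)

  module _ (b : Aut S) where
    open Aut b using (to)

    from : V S → V S
    from = Inverse.from (Aut.bij b)

    to-from : ∀ v → to (from v) ≡ v
    to-from = Inverse.strictlyInverseˡ (Aut.bij b)

    from-to : ∀ v → from (to v) ≡ v
    from-to = Inverse.strictlyInverseʳ (Aut.bij b)

    from-colour : ∀ v → colour S (from v) ≡ colour S v
    from-colour v = trans (sym (Aut.colour-pres b (from v))) (cong (colour S) (to-from v))

    restriction : Permutation′ n
    restriction = permutation to₀ from₀
      (λ y → inj₁-injective (begin
        inj₁ (to₀ (from₀ y))   ≡⟨ to₀-eq (from₀ y) ⟨
        to (inj₁ (from₀ y))   ≡⟨ cong to (from₀-eq y) ⟨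
        to (from (inj₁ y))    ≡⟨ to-from (inj₁ y) ⟩
        inj₁ y                ∎))
      (λ x → inj₁-injective (begin
        inj₁ (from₀ (to₀ x))   ≡⟨ from₀-eq (to₀ x) ⟨
        from (inj₁ (to₀ x))   ≡⟨ cong from (to₀-eq x) ⟨
        from (to (inj₁ x))    ≡⟨ from-to (inj₁ x) ⟩
        inj₁ x                ∎))
      where
        open ≡-Reasoning
        to₀ from₀ : Fin n → Fin n
        to₀ x = proj₁ (colour-nothing⇒base (to (inj₁ x)) (Aut.colour-pres b (inj₁ x)))
        from₀ x = proj₁ (colour-nothing⇒base (from (inj₁ x)) (from-colour (inj₁ x)))
        to₀-eq : ∀ x → to (inj₁ x) ≡ inj₁ (to₀ x)
        to₀-eq x = proj₂ (colour-nothing⇒base (to (inj₁ x)) (Aut.colour-pres b (inj₁ x)))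
        from₀-eq : ∀ x → from (inj₁ x) ≡ inj₁ (from₀ x)
        from₀-eq x = proj₂ (colour-nothing⇒base (from (inj₁ x)) (from-colour (inj₁ x)))

    restriction-restricts : Restricts S b restriction
    restriction-restricts x = proj₂ (colour-nothing⇒base (to (inj₁ x)) (Aut.colour-pres b (inj₁ x)))

    module _ (c : Permutation′ n) (restricts : Restricts S b c) where

      -- The copy of x must go to a copy of the same colour, i.e. of the same generator, and
      -- the undirected edge to x forces its base point to be c x.
      copy-image : ∀ i x p → Σ (False ((S i ⟨$⟩ʳ (c ⟨$⟩ʳ x)) ≟ (c ⟨$⟩ʳ x))) λ q →
        to (inj₂ (i , x , p)) ≡ inj₂ (i , c ⟨$⟩ʳ x , q)
      copy-image i x p with colour-just⇒copy (to (inj₂ (i , x , p))) i _ (Aut.colour-pres b _)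
      ... | (y , q) , image-eq
        with subst₂ (UEdge S) (restricts x) image-eq
               (Equivalence.to (Aut.uedge-pres b (inj₁ x) (inj₂ (i , x , p))) refl)
      ... | refl = q , image-eq

      commute-on-support : ∀ i x → False ((S i ⟨$⟩ʳ x) ≟ x) → c ⟨$⟩ʳ (S i ⟨$⟩ʳ x) ≡ S i ⟨$⟩ʳ (c ⟨$⟩ʳ x)
      commute-on-support i x p =
        proj₂ (subst₂ (DEdge S) (proj₂ (copy-image i x p)) (proj₂ (copy-image i (S i ⟨$⟩ʳ x) p′))
          (Equivalence.to (Aut.dedge-pres b (inj₂ (i , x , p)) (inj₂ (i , S i ⟨$⟩ʳ x , p′))) (refl , refl)))
        where p′ = support-closed i x p

      -- If c x were moved by s_i, its copy would have a preimage (i , z) with c z = c x,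
      -- so z = x would be moved too.
      fixed-points-preserved : ∀ i x → S i ⟨$⟩ʳ x ≡ x → S i ⟨$⟩ʳ (c ⟨$⟩ʳ x) ≡ c ⟨$⟩ʳ x
      fixed-points-preserved i x fixed with (S i ⟨$⟩ʳ (c ⟨$⟩ʳ x)) ≟ (c ⟨$⟩ʳ x)
      ... | yes e = e
      ... | no moved = ⊥-elim (toWitnessFalse q (subst (λ z → S i ⟨$⟩ʳ z ≡ z) (sym z≡x) fixed))
        where
          w : V S
          w = inj₂ (i , c ⟨$⟩ʳ x , fromWitnessFalse moved)
          preimage = colour-just⇒copy (from w) i _ (from-colour w)
          z = proj₁ (proj₁ preimage)
          q = proj₂ (proj₁ preimage)
          z≡x : z ≡ x
          z≡x = ⟨$⟩ʳ-injective c (copy-base-injective (begin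
            inj₂ (i , c ⟨$⟩ʳ z , proj₁ (copy-image i z q))   ≡⟨ proj₂ (copy-image i z q) ⟨
            to (inj₂ (i , z , q))                            ≡⟨ cong to (proj₂ preimage) ⟨
            to (from w)                                      ≡⟨ to-from w ⟩
            w                                                ∎))
            where open ≡-Reasoning

      restricts⇒commutesWithGenerators : CommutesWithGenerators (c ⟨$⟩ʳ_)
      restricts⇒commutesWithGenerators i x with (S i ⟨$⟩ʳ x) ≟ x
      ... | yes fixed = trans (cong (c ⟨$⟩ʳ_) fixed) (sym (fixed-points-preserved i x fixed))
      ... | no moved = commute-on-support i x (fromWitnessFalse moved)

  restriction-determines : ∀ b b′ c → Restricts S b c → Restricts S b′ c → ∀ v → Aut.to b v ≡ Aut.to b′ v
  restriction-determines b b′ c r r′ (inj₁ x) = trans (r x) (sym (r′ x))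
  restriction-determines b b′ c r r′ (inj₂ (i , x , p)) =
    trans (proj₂ (copy-image b c r i x p)) (trans (copy-≡ refl) (sym (proj₂ (copy-image b′ c r′ i x p))))

lemma8 : ∀ {n m : ℕ} (S : Fin m → Permutation′ n) →
    -- restriction is well defined and lands in the centralizer
    (∀ (b : Aut S) → Σ (Permutation′ n) λ c → Restricts S b c × InCentralizer S c)
    -- restriction is injective
    × (∀ (b b′ : Aut S) (c : Permutation′ n) → Restricts S b c → Restricts S b′ c →
        ∀ (v : V S) → Aut.to b v ≡ Aut.to b′ v)
    -- restriction is onto the centralizer
    × (∀ (c : Permutation′ n) → InCentralizer S c → Σ (Aut S) λ b → Restricts S b c)
    -- restriction is a homomorphism
    × (∀ (b b′ : Aut S) (c c′ : Permutation′ n) → Restricts S b c → Restricts S b′ c′ →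
        ∀ (x : Fin n) → Aut.to b (Aut.to b′ (inj₁ x)) ≡ inj₁ (c ⟨$⟩ʳ (c′ ⟨$⟩ʳ x)))
lemma8 S =
    (λ b → restriction S b , restriction-restricts S b ,
           commutesWithGenerators⇒InCentralizer S (restriction S b)
             (restricts⇒commutesWithGenerators S b (restriction S b) (restriction-restricts S b)))
  , restriction-determines S
  , (λ c central → liftAut S c (InCentralizer⇒commutesWithGenerators S c central) , λ x → refl)
  , λ b b′ c c′ r r′ x → trans (cong (Aut.to b) (r′ x)) (r (c′ ⟨$⟩ʳ x))
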